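{- Let $\beta=(\beta_0,\beta_1,\dots)$ be a sequence of positive numbers, let $\xi_{nk}=\xi_{nk}(\beta)$ be the Stirling polynomials of the second kind generated by $\beta$, and let $\xi^{(1)}_{nk}=\xi_{nk}(\beta^{(1)})$ where $\beta^{(1)}=(\beta_1,\beta_2,\dots)$. Then for all $n\ge1$ and $0\le k\le n$, $$\xi_{nk}=\xi^{(1)}_{n-1,k-1}+\xi_{n-1,k}\,\beta_0 .$$
   Context: For a sequence $\beta=(\beta_0,\beta_1,\dots)$ and $\omega=(\varepsilon_1,\dots,\varepsilon_n)\in\{0,1\}^n$, the weight is $w_n(\omega)=\prod_{m=1}^n g_m$, where $g_m=1$ if $\varepsilon_m=0$ and $g_m=\beta_{j}$ if $\varepsilon_m=1$, with $j=\#\{l<m:\varepsilon_l=0\}$. For $n\ge1$, $0\le k\le n$, $\xi_{nk}(\beta)=\sum w_n(\omega)$ over all $\omega\in\{0,1\}^n$ having exactly $k$ zeros; $\xi_{00}(\beta)=1$ and $\xi_{nk}(\beta)=0$ if $k<0$ or $k>n$. -}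

module Defs where

open import Level using (Level)
open import Algebra.Bundles using (CommutativeSemiring)
open import Data.Bool using (Bool; true; false; if_then_else_)
open import Data.Nat using (ℕ; zero; suc)
open import Data.Integer as ℤ using (ℤ; +_)
open import Data.List using (List; []; _∷_; _++_; map; foldr)
open import Data.Vec using (Vec; []; _∷_)
open import Relation.Nullary.Decidable using (⌊_⌋)

-- All words ω = (ε₁,…,εₙ) ∈ {0,1}ⁿ, encoded as Vec Bool n with
-- false ≙ 0 and true ≙ 1.
allWords : (n : ℕ) → List (Vec Bool n)
allWords zero    = [] ∷ []
allWords (suc n) = map (false ∷_) (allWords n) ++ map (true ∷_) (allWords n)

zeros : {n : ℕ} → Vec Bool n → ℕ
zeros []          = 0
zeros (false ∷ ω) = suc (zeros ω)
zeros (true ∷ ω)  = zeros ω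

module _ {c ℓ : Level} (R : CommutativeSemiring c ℓ) where
  open CommutativeSemiring R

  shift : (ℕ → Carrier) → (ℕ → Carrier)
  shift β i = β (suc i)

  -- weight' β j ω : product of the g_m along ω, where j is the number of
  -- zeros already read before ω.
  weight' : (ℕ → Carrier) → ℕ → {n : ℕ} → Vec Bool n → Carrier
  weight' β j []          = 1#
  weight' β j (false ∷ ω) = 1# * weight' β (suc j) ω
  weight' β j (true ∷ ω)  = β j * weight' β j ω

  weight : (ℕ → Carrier) → {n : ℕ} → Vec Bool n → Carrier
  weight β ω = weight' β 0 ω

  -- ξ_{nk}(β) = Σ_{ω ∈ {0,1}ⁿ, #zeros(ω) = k} w_n(ω), for integer k
  -- (hence 0 automatically when k < 0 or k > n, and ξ₀₀ = 1).
  ξ : (ℕ → Carrier) → ℕ → ℤ → Carrier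
  ξ β n k = foldr (λ ω acc → (if ⌊ + zeros ω ℤ.≟ k ⌋ then weight β ω else 0#) + acc)
                  0# (allWords n)

{-# OPTIONS --safe #-}
-- Split the words of length n by their first letter. A leading 1 contributes the
-- factor β₀ and leaves the number of zeros unchanged; a leading 0 raises the number
-- of zeros by one and shifts every later index into β by one, i.e. replaces β by β⁽¹⁾.
module Submission where

open import Defs
open import Level using (Level)
open import Algebra.Bundles using (CommutativeSemiring)
open import Data.Bool using (Bool; true; false; if_then_else_)
open import Data.Nat using (ℕ; _≤_; _∸_; suc; s≤s)
open import Data.Integer as ℤ using (ℤ; +_)
import Data.Integer.Properties as ℤ
open import Data.List using (List; []; _∷_; _++_; map; foldr)
open import Data.List.Properties using (foldr-map)
open import Data.Vec using (Vec; []; _∷_)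
open import Function.Bundles using (_⇔_; mk⇔)
import Relation.Binary.PropositionalEquality as ≡
open import Relation.Nullary.Decidable using (⌊_⌋; does; does-⇔; isYes≗does)
import Relation.Binary.Reasoning.Setoid as SetoidReasoning

+suc≡⇔≡-1 : (z : ℕ) (k : ℤ) → (+ suc z ≡.≡ k) ⇔ (+ z ≡.≡ k ℤ.- + 1)
+suc≡⇔≡-1 z k = mk⇔ to from
  where
  k-1≡pred[k] : k ℤ.- + 1 ≡.≡ ℤ.pred k
  k-1≡pred[k] = ℤ.+-comm k (ℤ.- + 1)

  to : + suc z ≡.≡ k → + z ≡.≡ k ℤ.- + 1
  to eq = ≡.trans (≡.sym (ℤ.pred-suc (+ z)))
                  (≡.trans (≡.cong ℤ.pred eq) (≡.sym k-1≡pred[k]))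

  from : + z ≡.≡ k ℤ.- + 1 → + suc z ≡.≡ k
  from eq = ≡.trans (≡.cong ℤ.suc (≡.trans eq k-1≡pred[k])) (ℤ.suc-pred k)

⌊+suc≟⌋≡⌊+≟-1⌋ : (z : ℕ) (k : ℤ) → ⌊ + suc z ℤ.≟ k ⌋ ≡.≡ ⌊ + z ℤ.≟ k ℤ.- + 1 ⌋
⌊+suc≟⌋≡⌊+≟-1⌋ z k = begin
  ⌊ + suc z ℤ.≟ k ⌋            ≡⟨ isYes≗does (+ suc z ℤ.≟ k) ⟩
  does (+ suc z ℤ.≟ k)         ≡⟨ does-⇔ (+suc≡⇔≡-1 z k) (+ suc z ℤ.≟ k) (+ z ℤ.≟ k ℤ.- + 1) ⟩
  does (+ z ℤ.≟ k ℤ.- + 1)     ≡⟨ ≡.sym (isYes≗does (+ z ℤ.≟ k ℤ.- + 1)) ⟩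
  ⌊ + z ℤ.≟ k ℤ.- + 1 ⌋        ∎
  where open ≡.≡-Reasoning

module _ {c ℓ : Level} (R : CommutativeSemiring c ℓ) where
  open CommutativeSemiring R
  open SetoidReasoning setoid

  sum : {A : Set} → (A → Carrier) → List A → Carrier
  sum f = foldr (λ x acc → f x + acc) 0#

  sum-++ : {A : Set} (f : A → Carrier) (xs ys : List A) →
           sum f (xs ++ ys) ≈ sum f xs + sum f ys
  sum-++ f []       ys = sym (+-identityˡ _)
  sum-++ f (x ∷ xs) ys = trans (+-congˡ (sum-++ f xs ys)) (sym (+-assoc _ _ _))

  sum-map : {A B : Set} (f : B → Carrier) (g : A → B) (xs : List A) →
            sum f (map g xs) ≡.≡ sum (λ x → f (g x)) xs
  sum-map f g = foldr-map _ g 0#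

  sum-cong : {A : Set} {f g : A → Carrier} → (∀ x → f x ≈ g x) →
             (xs : List A) → sum f xs ≈ sum g xs
  sum-cong f≈g []       = refl
  sum-cong f≈g (x ∷ xs) = +-cong (f≈g x) (sum-cong f≈g xs)

  sum-*ʳ : {A : Set} (f : A → Carrier) (a : Carrier) (xs : List A) →
           sum (λ x → f x * a) xs ≈ sum f xs * a
  sum-*ʳ f a []       = sym (zeroˡ a)
  sum-*ʳ f a (x ∷ xs) = trans (+-congˡ (sum-*ʳ f a xs)) (sym (distribʳ a _ _))

  weight'-suc : (β : ℕ → Carrier) (j : ℕ) {n : ℕ} (ω : Vec Bool n) →
                weight' R β (suc j) ω ≈ weight' R (shift R β) j ω
  weight'-suc β j []          = refl
  weight'-suc β j (false ∷ ω) = *-congˡ (weight'-suc β (suc j) ω)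
  weight'-suc β j (true ∷ ω)  = *-congˡ (weight'-suc β j ω)

  ξ-summand : (ℕ → Carrier) → ℤ → {n : ℕ} → Vec Bool n → Carrier
  ξ-summand β k ω = if ⌊ + zeros ω ℤ.≟ k ⌋ then weight R β ω else 0#

  ξ-summand-false∷ : (β : ℕ → Carrier) (k : ℤ) {n : ℕ} (ω : Vec Bool n) →
                     ξ-summand β k (false ∷ ω) ≈ ξ-summand (shift R β) (k ℤ.- + 1) ω
  ξ-summand-false∷ β k ω rewrite ⌊+suc≟⌋≡⌊+≟-1⌋ (zeros ω) k
    with ⌊ + zeros ω ℤ.≟ k ℤ.- + 1 ⌋
  ... | true  = trans (*-identityˡ _) (weight'-suc β 0 ω)
  ... | false = refl

  ξ-summand-true∷ : (β : ℕ → Carrier) (k : ℤ) {n : ℕ} (ω : Vec Bool n) →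
                    ξ-summand β k (true ∷ ω) ≈ ξ-summand β k ω * β 0
  ξ-summand-true∷ β k ω with ⌊ + zeros ω ℤ.≟ k ⌋
  ... | true  = *-comm _ _
  ... | false = sym (zeroˡ _)

  ξ-suc : (β : ℕ → Carrier) (m : ℕ) (k : ℤ) →
          ξ R β (suc m) k ≈ ξ R (shift R β) m (k ℤ.- + 1) + ξ R β m k * β 0
  ξ-suc β m k = begin
    sum F (map (false ∷_) W ++ map (true ∷_) W)
      ≈⟨ sum-++ F (map (false ∷_) W) (map (true ∷_) W) ⟩
    sum F (map (false ∷_) W) + sum F (map (true ∷_) W)
      ≡⟨ ≡.cong₂ _+_ (sum-map F (false ∷_) W) (sum-map F (true ∷_) W) ⟩
    sum (λ ω → F (false ∷ ω)) W + sum (λ ω → F (true ∷ ω)) W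
      ≈⟨ +-cong (sum-cong (ξ-summand-false∷ β k) W) (sum-cong (ξ-summand-true∷ β k) W) ⟩
    sum (ξ-summand (shift R β) (k ℤ.- + 1)) W + sum (λ ω → ξ-summand β k ω * β 0) W
      ≈⟨ +-congˡ (sum-*ʳ (ξ-summand β k) (β 0) W) ⟩
    sum (ξ-summand (shift R β) (k ℤ.- + 1)) W + sum (ξ-summand β k) W * β 0
      ∎
    where
    W : List (Vec Bool m)
    W = allWords m

    F : Vec Bool (suc m) → Carrier
    F = ξ-summand β k

theorem4p2 : {c ℓ : Level} (R : CommutativeSemiring c ℓ) →
    let open CommutativeSemiring R in
    (β : ℕ → Carrier) → (n k : ℕ) → 1 ≤ n → k ≤ n →
    ξ R β n (+ k) ≈ ξ R (shift R β) (n ∸ 1) (+ k ℤ.- + 1) + ξ R β (n ∸ 1) (+ k) * β 0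
theorem4p2 R β (suc m) k (s≤s _) _ = ξ-suc R β m (+ k)
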